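{- Let $(G,\mathcal F,\mathcal O)$ be an o-graph such that $|\mathcal F|\leq t$. Then $|\mathcal O|\leq 2^{8t}(8t)!$.
   Context: A flat path of a graph $G$ is a path of $G$ of length at least 3 whose interior vertices have degree 2 in $G$. An instance of the Induced Disjoint Paths problem on $G$ is a set $\mathcal W=\{(s_1,t_1),\ldots,(s_k,t_k)\}$ of pairs of vertices of $G$ such that all $2k$ vertices are distinct and the only edges among these vertices are of the form $s_it_i$ (its terminals are the vertices $s_i,t_i$). An o-graph is a triple $(G,\mathcal F,\mathcal O)$ where $G$ is a graph, $\mathcal F$ is a set consisting of some flat paths of $G$ of length at most 7 and some vertices of $G$ (viewed as paths of length 0), and $\mathcal O$ is a set of instances $\mathcal W$ of the Induced Disjoint Paths problem on $G$ such that every terminal of every $\mathcal W\in\mathcal O$ lies on some path of $\mathcal F$. -}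

module Defs where

open import Data.Nat using (ℕ; zero; suc; _≤_)
open import Data.Bool using (Bool; true; false; if_then_else_)
open import Data.Fin using (Fin)
open import Data.List using (List; []; _∷_; length; map; allFin)
open import Data.Nat.ListAction using (sum)
open import Data.List.Relation.Unary.All using (All)
open import Data.List.Relation.Unary.Any using (Any)
open import Data.List.Relation.Unary.Unique.Propositional using (Unique)
open import Data.List.Relation.Unary.AllPairs using (AllPairs)
open import Data.List.Relation.Unary.Linked using (Linked)
open import Data.List.Membership.Propositional using (_∈_)
open import Data.Product using (_×_; ∃)
open import Data.Sum using (_⊎_)
open import Relation.Binary.PropositionalEquality using (_≡_; _≢_)
open import Relation.Nullary using (¬_)

record Graph : Set where
  field
    n     : ℕ
    adj   : Fin n → Fin n → Bool
    sym   : ∀ u v → adj u v ≡ adj v u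
    irrefl : ∀ v → adj v v ≡ false

open Graph public

Adj : (G : Graph) → Fin (n G) → Fin (n G) → Set
Adj G u v = adj G u v ≡ true

deg : (G : Graph) → Fin (n G) → ℕ
deg G v = sum (map (λ u → if adj G v u then 1 else 0) (allFin (n G)))

-- A path is given by its nonempty sequence of distinct vertices, consecutive
-- ones adjacent. Its length is (number of vertices - 1).
IsPath : (G : Graph) → List (Fin (n G)) → Set
IsPath G p = (1 ≤ length p) × Unique p × Linked (Adj G) p

dropLast : ∀ {A : Set} → List A → List A
dropLast []           = []
dropLast (x ∷ [])     = []
dropLast (x ∷ y ∷ xs) = x ∷ dropLast (y ∷ xs)

interior : ∀ {A : Set} → List A → List A
interior []       = []
interior (x ∷ xs) = dropLast xs

-- flat path: path of length ≥ 3 (≥ 4 vertices) whose interior vertices have degree 2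
IsFlatPath : (G : Graph) → List (Fin (n G)) → Set
IsFlatPath G p = IsPath G p × 4 ≤ length p × All (λ v → deg G v ≡ 2) (interior p)

-- an element of F: a single vertex (path of length 0) or a flat path of length ≤ 7
IsFElem : (G : Graph) → List (Fin (n G)) → Set
IsFElem G p = (IsPath G p × length p ≡ 1) ⊎ (IsFlatPath G p × length p ≤ 8)

-- An instance of Induced Disjoint Paths: a set of ordered pairs (s,t),
-- given by its characteristic function.
Inst : Graph → Set
Inst G = Fin (n G) → Fin (n G) → Bool

IsTerminal : (G : Graph) → Inst G → Fin (n G) → Set
IsTerminal G W x = ∃ λ y → (W x y ≡ true) ⊎ (W y x ≡ true)

IsIDPInstance : (G : Graph) → Inst G → Set
IsIDPInstance G W =
  (∀ a b → W a b ≡ true → a ≢ b) ×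
  -- all 2k terminals distinct: two pairs sharing a vertex are the same pair
  (∀ a b c d → W a b ≡ true → W c d ≡ true →
     (a ≡ c ⊎ a ≡ d ⊎ b ≡ c ⊎ b ≡ d) → (a ≡ c × b ≡ d)) ×
  (∀ x y → IsTerminal G W x → IsTerminal G W y → Adj G x y →
     (W x y ≡ true) ⊎ (W y x ≡ true))

SameInst : (G : Graph) → Inst G → Inst G → Set
SameInst G W W′ = ∀ a b → W a b ≡ W′ a b

-- An o-graph (G, F, O). F is given as a list of paths (vertex sequences),
-- O as a list of pairwise distinct instances, so |O| = length O.
record OGraph : Set where
  field
    G      : Graph
    F      : List (List (Fin (n G)))
    O      : List (Inst G)
    F-ok   : All (IsFElem G) F
    O-inst : All (IsIDPInstance G) O
    O-set  : AllPairs (λ W W′ → ¬ SameInst G W W′) O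
    O-term : All (λ W → ∀ x → IsTerminal G W x → Any (λ p → x ∈ p) F) O

open OGraph public

-- An instance of O is a loopless set of pairwise disjoint ordered pairs whose
-- terminals lie in the list U of the at most 8t vertices of the paths of F.
-- On a vertex list x ∷ L such an instance either avoids x, and then lives on L,
-- or is obtained from an instance on L by adding xy or yx for some y ∈ L. The
-- candidates generated this way from the empty instance therefore cover all
-- instances, and there are at most (2m + 1)·2^m·m! ≤ 2^(m+1)·(m+1)! of them on
-- m + 1 vertices. The instances of O being pairwise different, pigeonhole gives
-- |O| ≤ 2^|U|·|U|! ≤ 2^(8t)·(8t)!.
module Submission where

open import Defs
open import Data.Nat using (ℕ; _≤_; _*_; _^_; _!)
open import Data.List using (length)

open import Level using (Level)
open import Data.Nat using (suc; _+_; z≤n; s≤s; _≤′_; ≤′-refl; ≤′-step)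
open import Data.Nat.Properties
  using (≤-refl; ≤-trans; ≤-reflexive; ≤⇒≤′; +-mono-≤; +-monoˡ-≤; +-monoʳ-≤; m≤m+n;
         *-comm; *-monoˡ-≤; *-monoʳ-≤; m≤m*n; module ≤-Reasoning)
open import Data.Nat.Tactic.RingSolver using (solve-∀)
open import Data.Bool using (Bool; true; false)
import Data.Bool.Properties as Bool
open import Data.Fin using (Fin; _≟_)
open import Data.List using (List; []; _∷_; _++_; map; concat; concatMap; [_])
open import Data.List.Properties using (length-++; length-map; length-removeAt′)
open import Data.List.Relation.Unary.All using (All; []; _∷_; universal)
import Data.List.Relation.Unary.All as All
import Data.List.Relation.Unary.All.Properties as All
open import Data.List.Relation.Unary.Any using (Any; here; there; index; _─_; any?)
import Data.List.Relation.Unary.Any as Any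
open import Data.List.Relation.Unary.Any.Properties using (++⁺ˡ; ++⁺ʳ; map⁺; concat⁺; concatMap⁺)
open import Data.List.Relation.Unary.AllPairs using (AllPairs; []; _∷_)
open import Data.List.Membership.Propositional using (_∈_; lose; find)
open import Data.Product using (_×_; _,_; proj₁)
open import Data.Sum using (_⊎_; inj₁; inj₂; swap; reduce; [_,_]′)
open import Data.Empty using (⊥-elim)
open import Relation.Binary.Bundles using (Setoid)
open import Relation.Binary.PropositionalEquality
  using (_≡_; _≢_; refl; cong; cong₂; module ≡-Reasoning)
  renaming (sym to ≡-sym; trans to ≡-trans)
open import Relation.Nullary using (¬_; Dec; yes; no)
open import Relation.Nullary.Decidable using (_×-dec_; _⊎-dec_)

private
  variable
    a ℓ : Level
    A : Set a

module _ (S : Setoid a ℓ) where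
  open Setoid S using (_≈_) renaming (Carrier to X; sym to ≈-sym; trans to ≈-trans)
  open import Data.List.Membership.Setoid S using () renaming (_∈_ to _∈ₛ_)

  ∈-─⁺ : ∀ {x y} {ys : List X} (x∈ys : x ∈ₛ ys) → ¬ y ≈ x → y ∈ₛ ys → y ∈ₛ (ys ─ x∈ys)
  ∈-─⁺ (here x≈z)   y≉x (here y≈z)   = ⊥-elim (y≉x (≈-trans y≈z (≈-sym x≈z)))
  ∈-─⁺ (here _)     y≉x (there y∈ys) = y∈ys
  ∈-─⁺ (there _)    y≉x (here y≈z)   = here y≈z
  ∈-─⁺ (there x∈ys) y≉x (there y∈ys) = there (∈-─⁺ x∈ys y≉x y∈ys)

  length-─ : ∀ {x} {ys : List X} (x∈ys : x ∈ₛ ys) → suc (length (ys ─ x∈ys)) ≡ length ys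
  length-─ {ys = ys@(_ ∷ _)} x∈ys = ≡-sym (length-removeAt′ ys (index x∈ys))

  unique-covered⇒length≤ : ∀ {xs ys : List X} → AllPairs (λ x y → ¬ x ≈ y) xs →
                           All (_∈ₛ ys) xs → length xs ≤ length ys
  unique-covered⇒length≤ []               []                = z≤n
  unique-covered⇒length≤ (x≉xs ∷ unique) (x∈ys ∷ xs⊆ys) =
    ≤-trans (s≤s (unique-covered⇒length≤ unique (removed x≉xs xs⊆ys))) (≤-reflexive (length-─ x∈ys))
    where
    removed : ∀ {zs} → All (λ z → ¬ _ ≈ z) zs → All (_∈ₛ _) zs → All (_∈ₛ (_ ─ x∈ys)) zs
    removed []          []            = []
    removed (x≉z ∷ x≉zs) (z∈ys ∷ zs⊆ys) =
      ∈-─⁺ x∈ys (λ z≈x → x≉z (≈-sym z≈x)) z∈ys ∷ removed x≉zs zs⊆ys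

length-concat≤ : ∀ {k} {xss : List (List A)} → All (λ xs → length xs ≤ k) xss →
                 length (concat xss) ≤ length xss * k
length-concat≤ []                       = z≤n
length-concat≤ {k = k} {xs ∷ xss} (xs≤k ∷ xss≤k) = begin
  length (xs ++ concat xss)        ≡⟨ length-++ xs ⟩
  length xs + length (concat xss)  ≤⟨ +-mono-≤ xs≤k (length-concat≤ xss≤k) ⟩
  k + length xss * k               ∎
  where open ≤-Reasoning

2^n*n!-step : ∀ n → 2 ^ n * n ! ≤ 2 ^ suc n * suc n !
2^n*n!-step n = ≤-trans (m≤m*n (2 ^ n * n !) (2 * suc n)) (≤-reflexive (identity n (2 ^ n) (n !)))
  where
  identity : ∀ n p f → p * f * (2 * suc n) ≡ 2 * p * (suc n * f)
  identity = solve-∀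

2^n*n!-mono-≤ : ∀ {m n} → m ≤ n → 2 ^ m * m ! ≤ 2 ^ n * n !
2^n*n!-mono-≤ m≤n = go (≤⇒≤′ m≤n)
  where
  go : ∀ {m n} → m ≤′ n → 2 ^ m * m ! ≤ 2 ^ n * n !
  go ≤′-refl          = ≤-refl
  go (≤′-step {n} m≤n) = ≤-trans (go m≤n) (2^n*n!-step n)

module _ (G : Graph) where
  private
    V : Set
    V = Fin (n G)

  instSetoid : Setoid _ _
  instSetoid = record
    { Carrier       = Inst G
    ; _≈_           = SameInst G
    ; isEquivalence = record
      { refl  = λ _ _ → refl
      ; sym   = λ W≈W′ a b → ≡-sym (W≈W′ a b)
      ; trans = λ W≈W′ W′≈W″ a b → ≡-trans (W≈W′ a b) (W′≈W″ a b)
      }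
    }

  Loopless : Inst G → Set
  Loopless W = ∀ a b → W a b ≡ true → a ≢ b

  PairwiseDisjoint : Inst G → Set
  PairwiseDisjoint W = ∀ a b c d → W a b ≡ true → W c d ≡ true →
    (a ≡ c ⊎ a ≡ d ⊎ b ≡ c ⊎ b ≡ d) → (a ≡ c × b ≡ d)

  Paired : Inst G → V → V → Set
  Paired W x y = W x y ≡ true ⊎ W y x ≡ true

  TerminalsIn : Inst G → List V → Set
  TerminalsIn W L = ∀ x → IsTerminal G W x → x ∈ L

  _[_,_]≔_ : Inst G → V → V → Bool → Inst G
  (W [ a , b ]≔ v) c d with a ≟ c ×-dec b ≟ d
  ... | yes _ = v
  ... | no _  = W c d

  erase-true : ∀ W a b c d → (W [ a , b ]≔ false) c d ≡ true → W c d ≡ true × ¬ (a ≡ c × b ≡ d)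
  erase-true W a b c d e with a ≟ c ×-dec b ≟ d
  ... | no ab≢cd = e , ab≢cd

  erase-restore : ∀ {W W′ a b} → W a b ≡ true → SameInst G (W [ a , b ]≔ false) W′ →
                  SameInst G W (W′ [ a , b ]≔ true)
  erase-restore {a = a} {b} Wab same c d with a ≟ c ×-dec b ≟ d | same c d
  ... | yes (refl , refl) | _ = Wab
  ... | no _              | e = e

  erase-loopless : ∀ W a b → Loopless W → Loopless (W [ a , b ]≔ false)
  erase-loopless W a b loopless c d e = loopless c d (proj₁ (erase-true W a b c d e))

  erase-disjoint : ∀ W a b → PairwiseDisjoint W → PairwiseDisjoint (W [ a , b ]≔ false)
  erase-disjoint W a b disjoint c d c′ d′ e e′ =
    disjoint c d c′ d′ (proj₁ (erase-true W a b c d e)) (proj₁ (erase-true W a b c′ d′ e′))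

  terminal-erase : ∀ W a b z → PairwiseDisjoint W → W a b ≡ true →
                   IsTerminal G (W [ a , b ]≔ false) z → IsTerminal G W z × z ≢ a × z ≢ b
  terminal-erase W a b z disjoint Wab (w , inj₁ e) with erase-true W a b z w e
  ... | Wzw , ab≢zw =
    (w , inj₁ Wzw) ,
    (λ { refl → ab≢zw (disjoint _ _ _ _ Wab Wzw (inj₁ refl)) }) ,
    (λ { refl → ab≢zw (disjoint _ _ _ _ Wab Wzw (inj₂ (inj₂ (inj₁ refl)))) })
  terminal-erase W a b z disjoint Wab (w , inj₂ e) with erase-true W a b w z e
  ... | Wwz , ab≢wz =
    (w , inj₂ Wwz) ,
    (λ { refl → ab≢wz (disjoint _ _ _ _ Wab Wwz (inj₂ (inj₁ refl))) }) ,
    (λ { refl → ab≢wz (disjoint _ _ _ _ Wab Wwz (inj₂ (inj₂ (inj₂ refl)))) })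

  paired? : ∀ W x y → Dec (Paired W x y)
  paired? W x y = (W x y Bool.≟ true) ⊎-dec (W y x Bool.≟ true)

  terminalsIn-erase : ∀ {W a b x L} → PairwiseDisjoint W → W a b ≡ true → x ≡ a ⊎ x ≡ b →
                      TerminalsIn W (x ∷ L) → TerminalsIn (W [ a , b ]≔ false) L
  terminalsIn-erase {W} {a} {b} disjoint Wab x∈ab inL z z-terminal
    with terminal-erase W a b z disjoint Wab z-terminal
  ... | z-terminalW , z≢a , z≢b with inL z z-terminalW
  ...   | there z∈L = z∈L
  ...   | here refl = ⊥-elim ([ z≢a , z≢b ]′ x∈ab)

  terminalsIn-unpaired : ∀ {W x L} → Loopless W → TerminalsIn W (x ∷ L) → ¬ Any (Paired W x) L →
                         TerminalsIn W L
  terminalsIn-unpaired loopless inL unpaired z z-terminal with inL z z-terminal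
  ... | there z∈L = z∈L
  ... | here refl with z-terminal
  ...   | w , zw with inL w (z , swap zw)
  ...     | here refl = ⊥-elim (loopless z z (reduce zw) refl)
  ...     | there w∈L = ⊥-elim (unpaired (lose w∈L zw))

  noPairs : Inst G
  noPairs _ _ = false

  noTerminals⇒noPairs : ∀ {W} → TerminalsIn W [] → SameInst G W noPairs
  noTerminals⇒noPairs {W} none a b with W a b in Wab
  ... | false = refl
  ... | true with none a (b , inj₁ Wab)
  ...   | ()

  bothOrientations : V → V → List (Inst G) → List (Inst G)
  bothOrientations x y C = map (_[ x , y ]≔ true) C ++ map (_[ y , x ]≔ true) C

  -- Not all candidates are matchings (y may be paired again inside the rest);
  -- only their number and the completeness lemma below matter.
  orientedMatchings : List V → List (Inst G)
  orientedMatchings []      = [ noPairs ]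
  orientedMatchings (x ∷ L) =
    orientedMatchings L ++ concatMap (λ y → bothOrientations x y (orientedMatchings L)) L

  length-bothOrientations : ∀ x y C → length (bothOrientations x y C) ≡ length C + length C
  length-bothOrientations x y C = begin
    length (map (_[ x , y ]≔ true) C ++ map (_[ y , x ]≔ true) C)
      ≡⟨ length-++ (map (_[ x , y ]≔ true) C) ⟩
    length (map (_[ x , y ]≔ true) C) + length (map (_[ y , x ]≔ true) C)
      ≡⟨ cong₂ _+_ (length-map (_[ x , y ]≔ true) C) (length-map (_[ y , x ]≔ true) C) ⟩
    length C + length C ∎
    where open ≡-Reasoning

  length-orientedMatchings : ∀ L → length (orientedMatchings L) ≤ 2 ^ length L * length L !
  length-orientedMatchings []      = ≤-refl
  length-orientedMatchings (x ∷ L) = begin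
    length (C ++ E)                   ≡⟨ length-++ C ⟩
    c + length E                      ≤⟨ +-monoʳ-≤ c length-E ⟩
    c + m * (c + c)                   ≤⟨ +-monoˡ-≤ (m * (c + c)) (m≤m+n c c) ⟩
    suc m * (c + c)                   ≤⟨ *-monoʳ-≤ (suc m) (+-mono-≤ ih ih) ⟩
    suc m * (B + B)                   ≡⟨ identity m (2 ^ m) (m !) ⟩
    2 ^ suc m * suc m !               ∎
    where
    open ≤-Reasoning
    C = orientedMatchings L
    E = concatMap (λ y → bothOrientations x y C) L
    c = length C
    m = length L
    B = 2 ^ m * m !
    ih = length-orientedMatchings L
    length-E : length E ≤ m * (c + c)
    length-E = ≤-trans
      (length-concat≤ (All.map⁺ (universal (λ y → ≤-reflexive (length-bothOrientations x y C)) L)))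
      (≤-reflexive (cong (_* (c + c)) (length-map (λ y → bothOrientations x y C) L)))
    identity : ∀ m p f → suc m * (p * f + p * f) ≡ 2 * p * (suc m * f)
    identity = solve-∀

  orientedMatchings-complete : ∀ L W → Loopless W → PairwiseDisjoint W → TerminalsIn W L →
                               Any (SameInst G W) (orientedMatchings L)
  erase-complete : ∀ {x} L W a b → Loopless W → PairwiseDisjoint W → TerminalsIn W (x ∷ L) →
                   W a b ≡ true → x ≡ a ⊎ x ≡ b →
                   Any (λ C → SameInst G W (C [ a , b ]≔ true)) (orientedMatchings L)

  orientedMatchings-complete []      W loopless disjoint none = here (noTerminals⇒noPairs none)
  orientedMatchings-complete (x ∷ L) W loopless disjoint inL with any? (paired? W x) L
  ... | no unpaired =
    ++⁺ˡ (orientedMatchings-complete L W loopless disjoint (terminalsIn-unpaired loopless inL unpaired))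
  ... | yes paired with find paired
  ...   | y , y∈L , inj₁ Wxy = ++⁺ʳ (orientedMatchings L) (concatMap⁺ _ (lose y∈L
            (++⁺ˡ (map⁺ (erase-complete L W x y loopless disjoint inL Wxy (inj₁ refl))))))
  ...   | y , y∈L , inj₂ Wyx = ++⁺ʳ (orientedMatchings L) (concatMap⁺ _ (lose y∈L
            (++⁺ʳ _ (map⁺ (erase-complete L W y x loopless disjoint inL Wyx (inj₂ refl))))))

  erase-complete L W a b loopless disjoint inL Wab x∈ab =
    Any.map (erase-restore Wab)
      (orientedMatchings-complete L (W [ a , b ]≔ false)
        (erase-loopless W a b loopless) (erase-disjoint W a b disjoint)
        (terminalsIn-erase disjoint Wab x∈ab inL))

fElem-length≤8 : ∀ {G p} → IsFElem G p → length p ≤ 8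
fElem-length≤8 (inj₁ (_ , length≡1)) = ≤-trans (≤-reflexive length≡1) (s≤s z≤n)
fElem-length≤8 (inj₂ (_ , length≤8)) = length≤8

mainTheorem8 : (t : ℕ) (X : OGraph) → length (F X) ≤ t →
    length (O X) ≤ 2 ^ (8 * t) * (8 * t) !
mainTheorem8 t X |F|≤t = begin
  length (O X)                        ≤⟨ unique-covered⇒length≤ (instSetoid (G X)) (O-set X) O-covered ⟩
  length (orientedMatchings (G X) U)  ≤⟨ length-orientedMatchings (G X) U ⟩
  2 ^ length U * length U !           ≤⟨ 2^n*n!-mono-≤ |U|≤8t ⟩
  2 ^ (8 * t) * (8 * t) !             ∎
  where
  open ≤-Reasoning
  U = concat (F X)
  |U|≤8t : length U ≤ 8 * t
  |U|≤8t = ≤-trans (length-concat≤ (All.map (fElem-length≤8 {G X}) (F-ok X)))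
                   (≤-trans (*-monoˡ-≤ 8 |F|≤t) (≤-reflexive (*-comm t 8)))
  O-covered : All (λ W → Any (SameInst (G X) W) (orientedMatchings (G X) U)) (O X)
  O-covered = All.zipWith
    (λ { ((loopless , disjoint , _) , terminalsInF) →
         orientedMatchings-complete (G X) U _ loopless disjoint (λ x t → concat⁺ (terminalsInF x t)) })
    (O-inst X , O-term X)
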